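{- Let $G=(V,E)$ be a graph with $n=|V|$ and let $w:E\to 2\mathbb{Z}$ assign even integer weights. Let $M$ be a perfect matching of $G$, let $\Omega$ be a laminar family of blossoms of $G$ (each $B\in\Omega$ an odd vertex set with $|B|\ge 3$ and an associated blossom edge set $E_B$), and let $y:V\to\mathbb{Z}$ and $z:\{B\subseteq V: |B|\ge 3 \text{ odd}\}\to\mathbb{Z}$. Suppose the following hold: (1) $z(B)$ is a nonnegative even integer for every odd $B$; (2) $|M\cap E_B|=\lfloor |B|/2\rfloor$ for all $B\in\Omega$; $z(B)>0$ for every $B\in\Omega$ not contained in another member of $\Omega$; and $z(B)=0$ for every odd $B\notin\Omega$; (3) $yz(e)\ge w(e)-2$ for every $e\in E$; (4) $yz(e)\le w(e)$ for every $e\in M\cup\bigcup_{B\in\Omega}E_B$. Then $w(M)\ge w(M^*)-n$, where $M^*$ is a perfect matching of $G$ of maximum weight $w(M^*)=\sum_{e\in M^*}w(e)$.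
   Context: For an edge $(u,v)$, $yz(u,v)=y(u)+y(v)+\sum_{B\supseteq\{u,v\}}z(B)$, the sum over odd vertex sets $B$ with $|B|\ge 3$ containing both endpoints. Blossoms (with respect to $M$) are defined inductively: for $v\in V$, $\{v\}$ is a trivial blossom with edge set $\emptyset$. If $\ell\ge 3$ is odd, $A_0,\ldots,A_{\ell-1}$ are disjoint vertex sets of blossoms with edge sets $E_{A_0},\ldots,E_{A_{\ell-1}}$, and there are edges $e_0,\ldots,e_{\ell-1}\in E$ with $e_i$ joining $A_i$ and $A_{i+1 \bmod \ell}$ such that $e_i\in M$ if and only if $i$ is odd, then $B=\bigcup_i A_i$ is a blossom with edge set $E_B=\bigcup_i E_{A_i}\cup\{e_0,\ldots,e_{\ell-1}\}$. A family of sets is laminar if any two members are disjoint or one contains the other. $w(M)=\sum_{e\in M}w(e)$. -}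

module Defs where

open import Data.Nat as ℕ using (ℕ; zero; suc; ⌊_/2⌋; NonZero)
import Data.Nat.Properties as ℕP
open import Data.Nat.DivMod using (_mod_)
open import Data.Integer as ℤ using (ℤ; +_)
open import Data.Fin using (Fin; toℕ)
open import Data.Fin.Subset using (Subset; _∈_; _∉_; _⊆_; _∩_; _∪_; ⋃; ⁅_⁆; ⊥; ∣_∣; inside; outside; Empty)
open import Data.Vec using ([]; _∷_)
open import Data.List as List using (List; []; _∷_; _++_)
open import Data.Product using (Σ; _×_; _,_; proj₁; proj₂)
open import Data.Sum using (_⊎_)
open import Relation.Binary.PropositionalEquality using (_≡_; _≢_)
open import Relation.Nullary using (¬_; Dec; yes; no)
open import Data.Bool using (if_then_else_)
open import Relation.Nullary.Decidable using (_×-dec_)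
open import Data.Fin.Subset.Properties using (_∈?_)
import Data.Vec

OddN : ℕ → Set
OddN k = k ℕ.% 2 ≡ 1

OddN? : (k : ℕ) → Dec (OddN k)
OddN? k = k ℕ.% 2 ℕP.≟ 1

Evenℤ : ℤ → Set
Evenℤ x = Σ ℤ λ k → x ≡ + 2 ℤ.* k

-- odd vertex sets with at least 3 elements (the domain of z)
OddSet : {n : ℕ} → Subset n → Set
OddSet B = OddN ∣ B ∣ × 3 ℕ.≤ ∣ B ∣

sumℤ : List ℤ → ℤ
sumℤ = List.foldr ℤ._+_ (+ 0)

sumFin : (m : ℕ) → (Fin m → ℤ) → ℤ
sumFin m f = sumℤ (List.tabulate f)

allSubsets : (n : ℕ) → List (Subset n)
allSubsets zero = [] ∷ []
allSubsets (suc n) = List.map (outside ∷_) (allSubsets n) ++ List.map (inside ∷_) (allSubsets n)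

sumSubsets : (n : ℕ) → {P : Subset n → Set} → ((B : Subset n) → Dec (P B)) → (Subset n → ℤ) → ℤ
sumSubsets n P? f = sumℤ (List.map (λ B → g B (P? B)) (allSubsets n))
  where
  g : ∀ {P : Set} (B : Subset n) → Dec P → ℤ
  g B (yes _) = f B
  g B (no _)  = + 0

-- A (multi)graph on vertex set Fin n with edges Fin m;
-- ends e = the two endpoints of edge e.

module Graph {n m : ℕ} (ends : Fin m → Fin n × Fin n) where

  Incident : Fin n → Fin m → Set
  Incident v e = v ≡ proj₁ (ends e) ⊎ v ≡ proj₂ (ends e)

  Joins : Fin m → Subset n → Subset n → Set
  Joins e A A' = (proj₁ (ends e) ∈ A × proj₂ (ends e) ∈ A')
               ⊎ (proj₂ (ends e) ∈ A × proj₁ (ends e) ∈ A')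

  IsPerfectMatching : Subset m → Set
  IsPerfectMatching M = ∀ v → Σ (Fin m) λ e → e ∈ M × Incident v e
                          × (∀ e' → e' ∈ M → Incident v e' → e' ≡ e)

  weight : (Fin m → ℤ) → Subset m → ℤ
  weight w M = sumFin m λ e → if Data.Vec.lookup M e then w e else + 0

  next : {k : ℕ} → Fin (suc k) → Fin (suc k)
  next {k} i = suc (toℕ i) mod (suc k)

  data IsBlossom (M : Subset m) : Subset n → Subset m → Set where
    trivial : (v : Fin n) → IsBlossom M ⁅ v ⁆ ⊥
    compose : (k : ℕ) → OddN (suc k) → 3 ℕ.≤ suc k →
              (A : Fin (suc k) → Subset n) (EA : Fin (suc k) → Subset m) →
              (∀ i → IsBlossom M (A i) (EA i)) →
              (∀ i j → i ≢ j → Empty (A i ∩ A j)) →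
              (e : Fin (suc k) → Fin m) →
              (∀ i → Joins (e i) (A i) (A (next i))) →
              (∀ i → (e i ∈ M → OddN (toℕ i)) × (OddN (toℕ i) → e i ∈ M)) →
              IsBlossom M (⋃ (List.tabulate A))
                          (⋃ (List.tabulate EA) ∪ ⋃ (List.tabulate (λ i → ⁅ e i ⁆)))

  yz : (y : Fin n → ℤ) (z : Subset n → ℤ) → Fin m → ℤ
  yz y z e = y u ℤ.+ y v ℤ.+ sumSubsets n P? z
    where
    u = proj₁ (ends e)
    v = proj₂ (ends e)
    P : Subset n → Set
    P B = OddSet B × u ∈ B × v ∈ B
    P? : (B : Subset n) → Dec (P B)
    P? B = (OddN? ∣ B ∣ ×-dec 3 ℕP.≤? ∣ B ∣) ×-dec (u ∈? B) ×-dec (v ∈? B)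

-- For a perfect matching N, summing yz over N gives Σ_v y(v) plus
-- Σ_B z(B)·|N[B]|, where N[B] is the set of edges of N with both ends in B,
-- because every vertex is covered exactly once. A matching has at most
-- ⌊|B|/2⌋ edges inside B, and M attains this on every blossom of Ω, while z
-- vanishes off Ω; since z ≥ 0, the yz-sum over Mstar is at most the one over
-- M. With w ≤ yz + 2 on the n/2 edges of Mstar and yz ≤ w on M this gives
-- w(Mstar) ≤ yz(Mstar) + n ≤ yz(M) + n ≤ w(M) + n.
module Submission where

open import Defs
open import Data.Bool using (Bool; true; false; _∧_; if_then_else_)
open import Data.Empty using (⊥-elim)
open import Data.Fin using (Fin; zero; suc; _≟_)
import Data.Fin.Properties as FinP
open import Data.Fin.Subset using (Subset; _∈_; _⊆_; _∩_; ∣_∣; Empty; inside; outside; ⋃; ⁅_⁆)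
open import Data.Fin.Subset.Properties
  using (_∈?_; ∉⊥; x∈p∪q⁻; x∈p∪q⁺; x∈p∩q⁻; x∈⁅y⁆⇒x≡y; p⊆q⇒∣p∣≤∣q∣)
open import Data.Integer as ℤ using (ℤ; +_; 0ℤ; 1ℤ; _+_; _-_; _*_; _≤_; +≤+; nonNegative)
import Data.Integer.Properties as ℤP
open import Data.Integer.Tactic.RingSolver using (solve-∀)
open import Data.List as List using (List; []; _∷_)
import Data.List.Properties as ListP
open import Data.List.Relation.Unary.Any using (Any; here; there)
open import Data.List.Relation.Unary.Any.Properties using (tabulate⁺; tabulate⁻)
open import Data.Nat as ℕ using (ℕ; zero; suc; ⌊_/2⌋)
import Data.Nat.Properties as ℕP
open import Data.Product using (Σ; _×_; _,_; proj₁; proj₂)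
open import Data.Sum using (_⊎_; inj₁; inj₂)
open import Data.Vec as Vec using ([]; _∷_; lookup)
import Data.Vec.Properties as VecP
open import Function using (_∘_)
open import Relation.Binary.PropositionalEquality
open import Relation.Nullary using (¬_; Dec; yes; no; does)
open import Relation.Nullary.Decidable using (_×-dec_; dec-true; dec-false; decidable-stable)

open import Algebra.Properties.Semiring.Sum ℤP.+-*-semiring
  using (sum; sum-syntax; sum-cong-≗; sum-replicate-zero; ∑-distrib-+; ∑-comm; *-distribˡ-sum)

i-k≤j⇒i≤j+k : ∀ {i j k} → i - k ≤ j → i ≤ j + k
i-k≤j⇒i≤j+k {i} {j} {k} i-k≤j = subst (_≤ j + k) (cancel i k) (ℤP.+-monoˡ-≤ k i-k≤j)
  where
  cancel : ∀ i k → i - k + k ≡ i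
  cancel = solve-∀

i≤j+k⇒i-k≤j : ∀ {i j k} → i ≤ j + k → i - k ≤ j
i≤j+k⇒i-k≤j {i} {j} {k} i≤j+k = subst (i - k ≤_) (cancel j k) (ℤP.+-monoˡ-≤ (ℤ.- k) i≤j+k)
  where
  cancel : ∀ j k → j + k - k ≡ j
  cancel = solve-∀

2*m≤n⇒m≤⌊n/2⌋ : ∀ {m n} → 2 ℕ.* m ℕ.≤ n → m ℕ.≤ ⌊ n /2⌋
2*m≤n⇒m≤⌊n/2⌋ {m} {n} 2m≤n = ℕP.≤-trans (ℕP.≤-reflexive (ℕP.n≡⌊n+n/2⌋ m))
  (ℕP.⌊n/2⌋-mono (subst (ℕ._≤ n) (cong (m ℕ.+_) (ℕP.+-identityʳ m)) 2m≤n))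

sumFin≡sum : ∀ k (f : Fin k → ℤ) → sumFin k f ≡ sum f
sumFin≡sum zero    f = refl
sumFin≡sum (suc k) f = cong (_+_ (f zero)) (sumFin≡sum k (f ∘ suc))

sumℤ-map≡sum-lookup : ∀ {A : Set} (xs : List A) (f : A → ℤ) →
  sumℤ (List.map f xs) ≡ sum (f ∘ List.lookup xs)
sumℤ-map≡sum-lookup []       f = refl
sumℤ-map≡sum-lookup (x ∷ xs) f = cong (_+_ (f x)) (sumℤ-map≡sum-lookup xs f)

sum-mono-≤ : ∀ {k} {f g : Fin k → ℤ} → (∀ i → f i ≤ g i) → sum f ≤ sum g
sum-mono-≤ {zero}  f≤g = ℤP.≤-refl
sum-mono-≤ {suc k} f≤g = ℤP.+-mono-≤ (f≤g zero) (sum-mono-≤ (f≤g ∘ suc))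

sum-zero : ∀ {k} {f : Fin k → ℤ} → (∀ i → f i ≡ 0ℤ) → sum f ≡ 0ℤ
sum-zero {k} f≡0 = trans (sum-cong-≗ f≡0) (sum-replicate-zero k)

sum-zero-except : ∀ {k} (f : Fin k → ℤ) i → (∀ j → j ≢ i → f j ≡ 0ℤ) → sum f ≡ f i
sum-zero-except f zero    f≡0 =
  trans (cong (_+_ (f zero)) (sum-zero (λ j → f≡0 (suc j) λ ()))) (ℤP.+-identityʳ (f zero))
sum-zero-except f (suc i) f≡0 =
  trans (cong₂ _+_ (f≡0 zero λ ())
                   (sum-zero-except (f ∘ suc) i λ j j≢i → f≡0 (suc j) (j≢i ∘ FinP.suc-injective)))
        (ℤP.+-identityˡ (f (suc i)))

sum-1≡+k : ∀ k → ∑[ i < k ] 1ℤ ≡ + k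
sum-1≡+k zero    = refl
sum-1≡+k (suc k) = cong (_+_ 1ℤ) (sum-1≡+k k)

𝟙 : Bool → ℤ
𝟙 true  = 1ℤ
𝟙 false = 0ℤ

𝟙-∧ : ∀ a b → 𝟙 (a ∧ b) ≡ 𝟙 a * 𝟙 b
𝟙-∧ true  b = sym (ℤP.*-identityˡ (𝟙 b))
𝟙-∧ false b = refl

if-does-*-mono-≤ : ∀ {P : Set} (d : Dec P) {x a b : ℤ} → (P → x * a ≤ x * b) →
  (if does d then x else 0ℤ) * a ≤ (if does d then x else 0ℤ) * b
if-does-*-mono-≤ (yes p) h = h p
if-does-*-mono-≤ (no  _) h = ℤP.≤-refl

double-both≤either : ∀ a b c → + 2 * (𝟙 a * 𝟙 (b ∧ c)) ≤ 𝟙 a * (𝟙 b + 𝟙 c)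
double-both≤either false b     c     = ℤP.≤-refl
double-both≤either true  true  true  = ℤP.≤-refl
double-both≤either true  true  false = +≤+ ℕ.z≤n
double-both≤either true  false true  = +≤+ ℕ.z≤n
double-both≤either true  false false = ℤP.≤-refl

sum-δ : ∀ {k} (f : Fin k → ℤ) a → ∑[ x < k ] (𝟙 (does (x ≟ a)) * f x) ≡ f a
sum-δ f a = trans (sum-zero-except _ a off) on
  where
  off : ∀ x → x ≢ a → 𝟙 (does (x ≟ a)) * f x ≡ 0ℤ
  off x x≢a rewrite dec-false (x ≟ a) x≢a = refl
  on : 𝟙 (does (a ≟ a)) * f a ≡ f a
  on rewrite dec-true (a ≟ a) refl = ℤP.*-identityˡ (f a)

+∣p∣≡sum𝟙 : ∀ {k} (p : Subset k) → + ∣ p ∣ ≡ ∑[ i < k ] 𝟙 (lookup p i)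
+∣p∣≡sum𝟙 []            = refl
+∣p∣≡sum𝟙 (inside  ∷ p) = cong (_+_ 1ℤ) (+∣p∣≡sum𝟙 p)
+∣p∣≡sum𝟙 (outside ∷ p) = trans (+∣p∣≡sum𝟙 p) (sym (ℤP.+-identityˡ _))

does-∈? : ∀ {k} x (p : Subset k) → does (x ∈? p) ≡ lookup p x
does-∈? zero    (inside  ∷ p) = refl
does-∈? zero    (outside ∷ p) = refl
does-∈? (suc x) (_       ∷ p) = does-∈? x p

x∈⋃⁻ : ∀ {k} {x : Fin k} (ps : List (Subset k)) → x ∈ ⋃ ps → Any (x ∈_) ps
x∈⋃⁻ []       x∈⋃ = ⊥-elim (∉⊥ x∈⋃)
x∈⋃⁻ (p ∷ ps) x∈⋃ with x∈p∪q⁻ p (⋃ ps) x∈⋃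
... | inj₁ x∈p  = here x∈p
... | inj₂ x∈ps = there (x∈⋃⁻ ps x∈ps)

x∈⋃⁺ : ∀ {k} {x : Fin k} {ps : List (Subset k)} → Any (x ∈_) ps → x ∈ ⋃ ps
x∈⋃⁺ (here x∈p)  = x∈p∪q⁺ (inj₁ x∈p)
x∈⋃⁺ (there x∈ps) = x∈p∪q⁺ (inj₂ (x∈⋃⁺ x∈ps))

⊆⋃-tabulate : ∀ {k l} (A : Fin l → Subset k) i → A i ⊆ ⋃ (List.tabulate A)
⊆⋃-tabulate A i x∈Aᵢ = x∈⋃⁺ (tabulate⁺ {f = A} i x∈Aᵢ)

∈⋃-tabulate⁻ : ∀ {k l} {x : Fin k} (A : Fin l → Subset k) →
  x ∈ ⋃ (List.tabulate A) → Σ (Fin l) λ i → x ∈ A i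
∈⋃-tabulate⁻ A = tabulate⁻ ∘ x∈⋃⁻ (List.tabulate A)

sumOver : ∀ {k} → Subset k → (Fin k → ℤ) → ℤ
sumOver {k} N f = ∑[ i < k ] (𝟙 (lookup N i) * f i)

sumOver-+ : ∀ {k} (N : Subset k) (f g : Fin k → ℤ) →
  sumOver N (λ i → f i + g i) ≡ sumOver N f + sumOver N g
sumOver-+ N f g = trans (sum-cong-≗ λ i → ℤP.*-distribˡ-+ (𝟙 (lookup N i)) (f i) (g i))
                        (∑-distrib-+ (λ i → 𝟙 (lookup N i) * f i) (λ i → 𝟙 (lookup N i) * g i))

sumOver-mono-≤ : ∀ {k} (N : Subset k) {f g : Fin k → ℤ} →
  (∀ i → i ∈ N → f i ≤ g i) → sumOver N f ≤ sumOver N g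
sumOver-mono-≤ N {f} {g} f≤g = sum-mono-≤ pointwise
  where
  pointwise : ∀ i → 𝟙 (lookup N i) * f i ≤ 𝟙 (lookup N i) * g i
  pointwise i with lookup N i in i∈N
  ... | false = ℤP.≤-refl
  ... | true  = ℤP.*-monoˡ-≤-nonNeg 1ℤ (f≤g i (VecP.lookup⇒[]= i N i∈N))

weight≡sumOver : ∀ {n m} (ends : Fin m → Fin n × Fin n) (w : Fin m → ℤ) (N : Subset m) →
  Graph.weight ends w N ≡ sumOver N w
weight≡sumOver {m = m} ends w N =
  trans (sumFin≡sum m _) (sum-cong-≗ λ e → if≡𝟙* (lookup N e) (w e))
  where
  if≡𝟙* : ∀ b x → (if b then x else 0ℤ) ≡ 𝟙 b * x
  if≡𝟙* true  x = sym (ℤP.*-identityˡ x)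
  if≡𝟙* false x = refl

subsetCount : ℕ → ℕ
subsetCount n = List.length (allSubsets n)

subsetAt : ∀ {n} → Fin (subsetCount n) → Subset n
subsetAt {n} = List.lookup (allSubsets n)

sumSubsets≡sum : ∀ n {P : Subset n → Set} (P? : ∀ B → Dec (P B)) (f : Subset n → ℤ) →
  sumSubsets n P? f ≡ ∑[ i < subsetCount n ] (𝟙 (does (P? (subsetAt i))) * f (subsetAt i))
sumSubsets≡sum n P? f = trans proof (sumℤ-map≡sum-lookup (allSubsets n) _)
  where
  -- The summand of sumSubsets is local to Defs; stating proof first lets
  -- Agda infer it as the left-hand side of sift.
  mutual
    proof : sumSubsets n P? f ≡ sumℤ (List.map (λ B → 𝟙 (does (P? B)) * f B) (allSubsets n))
    proof = cong sumℤ (ListP.map-cong sift (allSubsets n))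
    sift : ∀ B → _ ≡ 𝟙 (does (P? B)) * f B
    sift B with P? B
    ... | yes _ = sym (ℤP.*-identityˡ (f B))
    ... | no  _ = refl

module MatchingSums {n m : ℕ} (ends : Fin m → Fin n × Fin n) where
  open Graph ends

  end₁ end₂ : Fin m → Fin n
  end₁ = proj₁ ∘ ends
  end₂ = proj₂ ∘ ends

  spans : Subset n → Fin m → Bool
  spans B e = lookup B (end₁ e) ∧ lookup B (end₂ e)

  induced : Subset m → Subset n → Subset m
  induced N B = Vec.tabulate λ e → lookup N e ∧ spans B e

  +∣induced∣≡sumOver : ∀ N B → + ∣ induced N B ∣ ≡ sumOver N (𝟙 ∘ spans B)
  +∣induced∣≡sumOver N B = trans (+∣p∣≡sum𝟙 (induced N B)) (sum-cong-≗ λ e →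
    trans (cong 𝟙 (VecP.lookup∘tabulate _ e)) (𝟙-∧ (lookup N e) (spans B e)))

  ∈-induced⁺ : ∀ {N B e} → e ∈ N → end₁ e ∈ B → end₂ e ∈ B → e ∈ induced N B
  ∈-induced⁺ {N} {B} {e} e∈N u∈B v∈B = VecP.lookup⇒[]= e (induced N B) (begin
    lookup (induced N B) e                       ≡⟨ VecP.lookup∘tabulate _ e ⟩
    lookup N e ∧ lookup B (end₁ e) ∧ lookup B (end₂ e)
      ≡⟨ cong₂ _∧_ (VecP.[]=⇒lookup e∈N)
                   (cong₂ _∧_ (VecP.[]=⇒lookup u∈B) (VecP.[]=⇒lookup v∈B)) ⟩
    true                                         ∎)
    where open ≡-Reasoning

  edges-inside-blossom : ∀ {M B E} → IsBlossom M B E →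
    ∀ {e} → e ∈ E → end₁ e ∈ B × end₂ e ∈ B
  edges-inside-blossom (trivial _) e∈⊥ = ⊥-elim (∉⊥ e∈⊥)
  edges-inside-blossom (compose _ _ _ A EA blossoms _ cycle joins _) e∈E
    with x∈p∪q⁻ (⋃ (List.tabulate EA)) _ e∈E
  ... | inj₁ e∈EA with ∈⋃-tabulate⁻ EA e∈EA
  ...   | i , e∈EAᵢ with edges-inside-blossom (blossoms i) e∈EAᵢ
  ...     | u∈Aᵢ , v∈Aᵢ = ⊆⋃-tabulate A i u∈Aᵢ , ⊆⋃-tabulate A i v∈Aᵢ
  edges-inside-blossom (compose _ _ _ A EA blossoms _ cycle joins _) e∈E
    | inj₂ e∈cycle with ∈⋃-tabulate⁻ (λ i → ⁅ cycle i ⁆) e∈cycle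
  ...   | i , e∈⁅cycleᵢ⁆ with x∈⁅y⁆⇒x≡y (cycle i) e∈⁅cycleᵢ⁆
  ...     | refl with joins i
  ...       | inj₁ (u∈Aᵢ , v∈Aᵢ₊₁) = ⊆⋃-tabulate A i u∈Aᵢ , ⊆⋃-tabulate A (next i) v∈Aᵢ₊₁
  ...       | inj₂ (v∈Aᵢ , u∈Aᵢ₊₁) = ⊆⋃-tabulate A (next i) u∈Aᵢ₊₁ , ⊆⋃-tabulate A i v∈Aᵢ

  ∣N∩E∣≤∣induced∣ : ∀ {N B E} → (∀ {e} → e ∈ E → end₁ e ∈ B × end₂ e ∈ B) →
    ∣ N ∩ E ∣ ℕ.≤ ∣ induced N B ∣
  ∣N∩E∣≤∣induced∣ {N} {B} {E} inside-B = p⊆q⇒∣p∣≤∣q∣ λ e∈N∩E →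
    let e∈N , e∈E = x∈p∩q⁻ N E e∈N∩E
        u∈B , v∈B = inside-B e∈E
    in ∈-induced⁺ e∈N u∈B v∈B

  ⌊∣B∣/2⌋≤∣induced∣ : ∀ {M B E} → IsBlossom M B E → ∣ M ∩ E ∣ ≡ ⌊ ∣ B ∣ /2⌋ →
    ⌊ ∣ B ∣ /2⌋ ℕ.≤ ∣ induced M B ∣
  ⌊∣B∣/2⌋≤∣induced∣ {M} {B} blossom count =
    subst (ℕ._≤ ∣ induced M B ∣) count (∣N∩E∣≤∣induced∣ {M} (edges-inside-blossom blossom))

  oddSet? : (B : Subset n) → Dec (OddSet B)
  oddSet? B = OddN? ∣ B ∣ ×-dec 3 ℕP.≤? ∣ B ∣

  zOdd : (Subset n → ℤ) → Subset n → ℤ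
  zOdd z B = if does (oddSet? B) then z B else 0ℤ

  yz≡ends+∑spans : ∀ y z e → yz y z e ≡ y (end₁ e) + y (end₂ e)
    + ∑[ i < subsetCount n ] (𝟙 (spans (subsetAt i) e) * zOdd z (subsetAt i))
  yz≡ends+∑spans y z e = cong (_+_ (y (end₁ e) + y (end₂ e)))
    (trans (sumSubsets≡sum n spanned? z) (sum-cong-≗ λ i → regroup (subsetAt i)))
    where
    spanned? : ∀ B → Dec (OddSet B × end₁ e ∈ B × end₂ e ∈ B)
    spanned? B = oddSet? B ×-dec end₁ e ∈? B ×-dec end₂ e ∈? B
    restrict : ∀ o s x → 𝟙 (o ∧ s) * x ≡ 𝟙 s * (if o then x else 0ℤ)
    restrict true  s x = refl
    restrict false s x = sym (ℤP.*-zeroʳ (𝟙 s))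
    regroup : ∀ B → 𝟙 (does (spanned? B)) * z B ≡ 𝟙 (spans B e) * zOdd z B
    regroup B rewrite does-∈? (end₁ e) B | does-∈? (end₂ e) B = restrict _ (spans B e) (z B)

  sumOver-spans : ∀ N {k} (C : Fin k → Subset n) (g : Fin k → ℤ) →
    sumOver N (λ e → ∑[ i < k ] (𝟙 (spans (C i) e) * g i))
      ≡ ∑[ i < k ] (g i * + ∣ induced N (C i) ∣)
  sumOver-spans N C g = begin
    sumOver N (λ e → ∑[ i < _ ] (𝟙 (spans (C i) e) * g i))
      ≡⟨ sum-cong-≗ (λ e → *-distribˡ-sum (𝟙 (lookup N e)) (λ i → 𝟙 (spans (C i) e) * g i)) ⟩
    ∑[ e < m ] ∑[ i < _ ] (𝟙 (lookup N e) * (𝟙 (spans (C i) e) * g i))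
      ≡⟨ ∑-comm (λ e i → 𝟙 (lookup N e) * (𝟙 (spans (C i) e) * g i)) ⟩
    ∑[ i < _ ] ∑[ e < m ] (𝟙 (lookup N e) * (𝟙 (spans (C i) e) * g i))
      ≡⟨ sum-cong-≗ (λ i → trans (sum-cong-≗ λ e → swap (𝟙 (lookup N e)) (𝟙 (spans (C i) e)) (g i))
                                 (sym (*-distribˡ-sum (g i) λ e → 𝟙 (lookup N e) * 𝟙 (spans (C i) e)))) ⟩
    ∑[ i < _ ] (g i * sumOver N (𝟙 ∘ spans (C i)))
      ≡⟨ sum-cong-≗ (λ i → cong (g i *_) (sym (+∣induced∣≡sumOver N (C i)))) ⟩
    ∑[ i < _ ] (g i * + ∣ induced N (C i) ∣) ∎
    where
    open ≡-Reasoning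
    swap : ∀ a b c → a * (b * c) ≡ c * (a * b)
    swap = solve-∀


  incidence : Fin n → Fin m → ℤ
  incidence x e = 𝟙 (does (x ≟ end₁ e)) + 𝟙 (does (x ≟ end₂ e))

  module PerfectMatching (loopless : ∀ e → end₁ e ≢ end₂ e)
                         {N : Subset m} (perfect : IsPerfectMatching N) where

    sumOver-incidence≡1 : ∀ x → sumOver N (incidence x) ≡ 1ℤ
    sumOver-incidence≡1 x with perfect x
    ... | e₀ , e₀∈N , x∼e₀ , unique = trans (sum-zero-except _ e₀ off) (on x∼e₀)
      where
      off : ∀ e → e ≢ e₀ → 𝟙 (lookup N e) * incidence x e ≡ 0ℤ
      off e e≢e₀ with lookup N e in e∈N
      ... | false = refl
      ... | true
        rewrite dec-false (x ≟ end₁ e) (e≢e₀ ∘ unique e (VecP.lookup⇒[]= e N e∈N) ∘ inj₁)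
              | dec-false (x ≟ end₂ e) (e≢e₀ ∘ unique e (VecP.lookup⇒[]= e N e∈N) ∘ inj₂) = refl
      on : Incident x e₀ → 𝟙 (lookup N e₀) * incidence x e₀ ≡ 1ℤ
      on (inj₁ x≡u) rewrite VecP.[]=⇒lookup e₀∈N
                          | dec-true (x ≟ end₁ e₀) x≡u
                          | dec-false (x ≟ end₂ e₀) (loopless e₀ ∘ trans (sym x≡u)) = refl
      on (inj₂ x≡v) rewrite VecP.[]=⇒lookup e₀∈N
                          | dec-false (x ≟ end₁ e₀) (λ x≡u → loopless e₀ (trans (sym x≡u) x≡v))
                          | dec-true (x ≟ end₂ e₀) x≡v = refl

    sumOver-ends≡sum : ∀ f → sumOver N (λ e → f (end₁ e) + f (end₂ e)) ≡ sum f
    sumOver-ends≡sum f = begin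
      sumOver N (λ e → f (end₁ e) + f (end₂ e))
        ≡⟨ sum-cong-≗ spread ⟩
      ∑[ e < m ] ∑[ x < n ] (f x * (𝟙 (lookup N e) * incidence x e))
        ≡⟨ ∑-comm (λ e x → f x * (𝟙 (lookup N e) * incidence x e)) ⟩
      ∑[ x < n ] ∑[ e < m ] (f x * (𝟙 (lookup N e) * incidence x e))
        ≡⟨ sum-cong-≗ (λ x → sym (*-distribˡ-sum (f x) λ e → 𝟙 (lookup N e) * incidence x e)) ⟩
      ∑[ x < n ] (f x * sumOver N (incidence x))
        ≡⟨ sum-cong-≗ (λ x → trans (cong (f x *_) (sumOver-incidence≡1 x)) (ℤP.*-identityʳ (f x))) ⟩
      sum f ∎
      where
      open ≡-Reasoning
      regroup : ∀ b p q c → b * (p * c + q * c) ≡ c * (b * (p + q))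
      regroup = solve-∀
      spread : ∀ e → 𝟙 (lookup N e) * (f (end₁ e) + f (end₂ e))
                   ≡ ∑[ x < n ] (f x * (𝟙 (lookup N e) * incidence x e))
      spread e = begin
        b * (f (end₁ e) + f (end₂ e))
          ≡⟨ cong₂ (λ p q → b * (p + q)) (sym (sum-δ f (end₁ e))) (sym (sum-δ f (end₂ e))) ⟩
        b * (∑[ x < n ] (δ₁ x * f x) + ∑[ x < n ] (δ₂ x * f x))
          ≡⟨ cong (b *_) (sym (∑-distrib-+ (λ x → δ₁ x * f x) (λ x → δ₂ x * f x))) ⟩
        b * ∑[ x < n ] (δ₁ x * f x + δ₂ x * f x)
          ≡⟨ *-distribˡ-sum b (λ x → δ₁ x * f x + δ₂ x * f x) ⟩
        ∑[ x < n ] (b * (δ₁ x * f x + δ₂ x * f x))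
          ≡⟨ sum-cong-≗ (λ x → regroup b (δ₁ x) (δ₂ x) (f x)) ⟩
        ∑[ x < n ] (f x * (b * incidence x e)) ∎
        where
        b = 𝟙 (lookup N e)
        δ₁ δ₂ : Fin n → ℤ
        δ₁ x = 𝟙 (does (x ≟ end₁ e))
        δ₂ x = 𝟙 (does (x ≟ end₂ e))

    ∣induced∣≤⌊∣B∣/2⌋ : ∀ B → ∣ induced N B ∣ ℕ.≤ ⌊ ∣ B ∣ /2⌋
    ∣induced∣≤⌊∣B∣/2⌋ B = 2*m≤n⇒m≤⌊n/2⌋ (ℤP.drop‿+≤+ (begin
      + (2 ℕ.* ∣ induced N B ∣)        ≡⟨ ℤP.pos-* 2 ∣ induced N B ∣ ⟩
      + 2 * + ∣ induced N B ∣          ≡⟨ cong (_*_ (+ 2)) (+∣induced∣≡sumOver N B) ⟩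
      + 2 * sumOver N (𝟙 ∘ spans B)
        ≡⟨ *-distribˡ-sum (+ 2) (λ e → 𝟙 (lookup N e) * 𝟙 (spans B e)) ⟩
      ∑[ e < m ] (+ 2 * (𝟙 (lookup N e) * 𝟙 (spans B e)))
        ≤⟨ sum-mono-≤ (λ e → double-both≤either (lookup N e) (lookup B (end₁ e)) (lookup B (end₂ e))) ⟩
      sumOver N (λ e → 𝟙 (lookup B (end₁ e)) + 𝟙 (lookup B (end₂ e)))
        ≡⟨ sumOver-ends≡sum (𝟙 ∘ lookup B) ⟩
      ∑[ x < n ] 𝟙 (lookup B x)        ≡⟨ sym (+∣p∣≡sum𝟙 B) ⟩
      + ∣ B ∣                          ∎))
      where open ℤP.≤-Reasoning

    sumOver-yz≡∑y+∑z∣induced∣ : ∀ y z → sumOver N (yz y z)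
      ≡ sum y + ∑[ i < subsetCount n ] (zOdd z (subsetAt i) * + ∣ induced N (subsetAt i) ∣)
    sumOver-yz≡∑y+∑z∣induced∣ y z = begin
      sumOver N (yz y z)
        ≡⟨ sum-cong-≗ (λ e → cong (𝟙 (lookup N e) *_) (yz≡ends+∑spans y z e)) ⟩
      sumOver N (λ e → y (end₁ e) + y (end₂ e) + Z e)
        ≡⟨ sumOver-+ N (λ e → y (end₁ e) + y (end₂ e)) Z ⟩
      sumOver N (λ e → y (end₁ e) + y (end₂ e)) + sumOver N Z
        ≡⟨ cong₂ _+_ (sumOver-ends≡sum y) (sumOver-spans N subsetAt (zOdd z ∘ subsetAt)) ⟩
      sum y + ∑[ i < subsetCount n ] (zOdd z (subsetAt i) * + ∣ induced N (subsetAt i) ∣) ∎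
      where
      open ≡-Reasoning
      Z : Fin m → ℤ
      Z e = ∑[ i < subsetCount n ] (𝟙 (spans (subsetAt i) e) * zOdd z (subsetAt i))

    sumOver-≤+n : ∀ {f g : Fin m → ℤ} → (∀ e → f e - + 2 ≤ g e) → sumOver N f ≤ sumOver N g + + n
    sumOver-≤+n {f} {g} f-2≤g = begin
      sumOver N f                               ≤⟨ sumOver-mono-≤ N (λ e _ → i-k≤j⇒i≤j+k (f-2≤g e)) ⟩
      sumOver N (λ e → g e + (1ℤ + 1ℤ))         ≡⟨ sumOver-+ N g (λ _ → 1ℤ + 1ℤ) ⟩
      sumOver N g + sumOver N (λ _ → 1ℤ + 1ℤ)   ≡⟨ cong (_+_ (sumOver N g)) (sumOver-ends≡sum (λ _ → 1ℤ)) ⟩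
      sumOver N g + ∑[ x < n ] 1ℤ               ≡⟨ cong (_+_ (sumOver N g)) (sum-1≡+k n) ⟩
      sumOver N g + + n                         ∎
      where open ℤP.≤-Reasoning

    zOdd*∣induced∣-≤ : ∀ {M} {Ω : Subset n → Set} z →
      (∀ B → Ω B → ⌊ ∣ B ∣ /2⌋ ℕ.≤ ∣ induced M B ∣) →
      (∀ B → OddSet B → 0ℤ ≤ z B) → (∀ B → OddSet B → ¬ Ω B → z B ≡ 0ℤ) →
      ∀ B → zOdd z B * + ∣ induced N B ∣ ≤ zOdd z B * + ∣ induced M B ∣
    zOdd*∣induced∣-≤ {M} {Ω} z tight z≥0 z-outside B = if-does-*-mono-≤ (oddSet? B) λ odd →
      decidable-stable (_ ℤP.≤? _) λ ≰ → ≰ (vanishing (z-outside B odd (≰ ∘ tightened odd)))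
      where
      -- Ω B need not be decidable, but the inequality is, and it holds
      -- both when B ∈ Ω and when z B = 0.
      tightened : OddSet B → Ω B → z B * + ∣ induced N B ∣ ≤ z B * + ∣ induced M B ∣
      tightened odd B∈Ω = ℤP.*-monoˡ-≤-nonNeg (z B) {{nonNegative (z≥0 B odd)}}
        (+≤+ (ℕP.≤-trans (∣induced∣≤⌊∣B∣/2⌋ B) (tight B B∈Ω)))
      vanishing : z B ≡ 0ℤ → z B * + ∣ induced N B ∣ ≤ z B * + ∣ induced M B ∣
      vanishing z≡0 rewrite z≡0 = ℤP.≤-refl

mainTheorem3 : (n m : ℕ) (ends : Fin m → Fin n × Fin n) →
    (∀ e → proj₁ (ends e) ≢ proj₂ (ends e)) →
    let open Graph ends in
    (w : Fin m → ℤ) → (∀ e → Evenℤ (w e)) →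
    (M : Subset m) → IsPerfectMatching M →
    (Ω : Subset n → Set) (EΩ : Subset n → Subset m) →
    (∀ B → Ω B → OddSet B × IsBlossom M B (EΩ B)) →
    (∀ B B′ → Ω B → Ω B′ → Empty (B ∩ B′) ⊎ B ⊆ B′ ⊎ B′ ⊆ B) →
    (y : Fin n → ℤ) (z : Subset n → ℤ) →
    (∀ B → OddSet B → ℤ.0ℤ ℤ.≤ z B × Evenℤ (z B)) →
    (∀ B → Ω B → ∣ M ∩ EΩ B ∣ ≡ ⌊ ∣ B ∣ /2⌋) →
    (∀ B → Ω B → (∀ B′ → Ω B′ → B ⊆ B′ → B′ ≡ B) → ℤ.0ℤ ℤ.< z B) →
    (∀ B → OddSet B → ¬ Ω B → z B ≡ ℤ.0ℤ) →
    (∀ e → w e ℤ.- + 2 ℤ.≤ yz y z e) →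
    (∀ e → (e ∈ M ⊎ Σ (Subset n) λ B → Ω B × e ∈ EΩ B) → yz y z e ℤ.≤ w e) →
    (Mstar : Subset m) → IsPerfectMatching Mstar →
    (∀ M′ → IsPerfectMatching M′ → weight w M′ ℤ.≤ weight w Mstar) →
    weight w Mstar ℤ.- + n ℤ.≤ weight w M
mainTheorem3 n m ends loopless w _ M M-perfect Ω EΩ Ω-blossoms _ y z z-sign M-blossoms _ z-outside
             yz-lower yz-upper M* M*-perfect _ = i≤j+k⇒i-k≤j (begin
  weight w M*               ≡⟨ weight≡sumOver ends w M* ⟩
  sumOver M* w              ≤⟨ M*.sumOver-≤+n yz-lower ⟩
  sumOver M* (yz y z) + + n ≤⟨ ℤP.+-monoˡ-≤ (+ n) yz-sums-≤ ⟩
  sumOver M (yz y z) + + n  ≤⟨ ℤP.+-monoˡ-≤ (+ n) (sumOver-mono-≤ M λ e e∈M → yz-upper e (inj₁ e∈M)) ⟩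
  sumOver M w + + n         ≡⟨ cong (_+ + n) (weight≡sumOver ends w M) ⟨
  weight w M + + n          ∎)
  where
  open Graph ends
  open MatchingSums ends
  module M  = PerfectMatching loopless M-perfect
  module M* = PerfectMatching loopless M*-perfect
  open ℤP.≤-Reasoning
  tight : ∀ B → Ω B → ⌊ ∣ B ∣ /2⌋ ℕ.≤ ∣ induced M B ∣
  tight B B∈Ω = ⌊∣B∣/2⌋≤∣induced∣ (proj₂ (Ω-blossoms B B∈Ω)) (M-blossoms B B∈Ω)
  yz-sums-≤ : sumOver M* (yz y z) ≤ sumOver M (yz y z)
  yz-sums-≤ = begin
    sumOver M* (yz y z)
      ≡⟨ M*.sumOver-yz≡∑y+∑z∣induced∣ y z ⟩
    sum y + ∑[ i < subsetCount n ] (zOdd z (subsetAt i) * + ∣ induced M* (subsetAt i) ∣)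
      ≤⟨ ℤP.+-monoʳ-≤ (sum y) (sum-mono-≤ λ i →
           M*.zOdd*∣induced∣-≤ {M} z tight (λ B → proj₁ ∘ z-sign B) z-outside (subsetAt i)) ⟩
    sum y + ∑[ i < subsetCount n ] (zOdd z (subsetAt i) * + ∣ induced M (subsetAt i) ∣)
      ≡⟨ M.sumOver-yz≡∑y+∑z∣induced∣ y z ⟨
    sumOver M (yz y z) ∎
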